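{- Let $G$ be a graph and $k\ge1$ an integer. If the cop has $k$-cornered the robber, then whatever move the robber makes, the cop can $k$-catch the robber on her next move.
   Context: All graphs are finite, nonempty and reflexive (every vertex adjacent to itself); a move is staying put or moving to an adjacent vertex. For distinct vertices $v,w$ of a graph $H$: $w$ corners $v$ in $H$ if every vertex of $H$ adjacent to $v$ is adjacent to $w$; strictly corners if moreover some vertex of $H$ adjacent to $w$ is not adjacent to $v$; a strict corner of $H$ is a vertex strictly cornered in $H$ by another vertex. We also say $c$ corners $x$ in $H$ when $c=x$. Corner ranking: $G_1=G$, $k=1$. If $G_k$ is a clique, its vertices get rank $k$; stop. Else if $G_k$ has no strict corners, its vertices get rank $\infty$; stop. Else the set $X$ of strict corners of $G_k$ gets rank $k$, $G_{k+1}=G_k-X$, increase $k$, repeat. $\mathrm{cr}(v)$ is the rank of $v$. Projections: for $k$ with $G_{k+1}$ defined, $f_k(\{u\})=\{u\}$ if $\mathrm{cr}(u)>k$, otherwise the set of vertices of $G_{k+1}$ that strictly corner $u$ in $G_k$; $f_k(S)=\bigcup_{u\in S}f_k(\{u\})$; $F_1$ the identity, $F_k=f_{k-1}\circ\cdots\circ f_1$, $F_k(v)=F_k(\{v\})$. With the cop at $c$ and robber at $x$: for $k\ge1$, $x$ is $k$-cornered by $c$ if some $x'\in F_k(x)$ is cornered by $c$ in the subgraph induced by $V(G_k)\cup\{c\}$; the cop has $k$-caught the robber if $c\in F_k(x)$. -}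

module Defs where

open import Data.Nat using (ℕ; zero; suc; _<_)
open import Data.Fin using (Fin)
open import Data.Product using (Σ; ∃; _×_; _,_)
open import Data.Sum using (_⊎_)
open import Data.Unit using (⊤)
open import Data.Empty using (⊥)
open import Relation.Nullary using (¬_)
open import Relation.Binary using (Decidable)
open import Relation.Binary.PropositionalEquality using (_≡_; _≢_)

record Graph : Set₁ where
  field
    n     : ℕ
    nonempty : 0 < n
    _~_   : Fin n → Fin n → Set
    ~-dec : Decidable _~_
    ~-refl : ∀ v → v ~ v
    ~-sym  : ∀ {v w} → v ~ w → w ~ v

module _ (G : Graph) where
  open Graph G

  Vertex : Set
  Vertex = Fin n

  -- an induced subgraph is given by a predicate on vertices
  VSet : Set₁
  VSet = Vertex → Set

  -- w corners v in H (for distinct v,w): every vertex of H adjacent to v is adjacent to w.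
  -- Convention from the paper: c also corners x when c = x.
  Corners : VSet → Vertex → Vertex → Set
  Corners H w v = w ≡ v ⊎ (w ≢ v × (∀ y → H y → y ~ v → y ~ w))

  StrictlyCorners : VSet → Vertex → Vertex → Set
  StrictlyCorners H w v =
    w ≢ v × (∀ y → H y → y ~ v → y ~ w) × (∃ λ y → H y × y ~ w × ¬ (y ~ v))

  StrictCorner : VSet → Vertex → Set
  StrictCorner H v = H v × ∃ λ w → H w × StrictlyCorners H w v

  Clique : VSet → Set
  Clique H = ∀ v w → H v → H w → v ~ w

  -- Vertex sets of G_k (paper indexing, k ≥ 1; index 0 is a dummy copy of G_1).
  -- G_{k+1} = G_k minus the strict corners of G_k.
  V : ℕ → VSet
  V zero v = ⊤
  V (suc zero) v = ⊤
  V (suc (suc k)) v = V (suc k) v × ¬ StrictCorner (V (suc k)) v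

  Defined : ℕ → Set
  Defined zero = ⊥
  Defined (suc zero) = ⊤
  Defined (suc (suc k)) =
    Defined (suc k) × ¬ Clique (V (suc k)) × (∃ λ v → StrictCorner (V (suc k)) v)

  data Rank : Set where
    fin : ℕ → Rank
    ∞   : Rank

  HasRank : Vertex → Rank → Set
  HasRank u (fin k) =
    Defined k × V k u × (Clique (V k) ⊎ StrictCorner (V k) u)
  HasRank u ∞ = ∃ λ k →
    Defined k × V k u × ¬ Clique (V k) × ¬ (∃ λ v → StrictCorner (V k) v)

  _>ʳ_ : Rank → ℕ → Set
  fin r >ʳ k = k < r
  ∞ >ʳ k = ⊤

  RankAbove : Vertex → ℕ → Set
  RankAbove u k = ∃ λ r → HasRank u r × r >ʳ k

  InProj : ℕ → Vertex → Vertex → Set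
  InProj k u x =
    (RankAbove u k × x ≡ u)
    ⊎ (¬ RankAbove u k × V (suc k) x × StrictlyCorners (V k) x u)

  InF : ℕ → Vertex → Vertex → Set
  InF zero v x = x ≡ v
  InF (suc zero) v x = x ≡ v
  InF (suc (suc k)) v x = ∃ λ u → InF (suc k) v u × InProj (suc k) u x

  VPlus : ℕ → Vertex → VSet
  VPlus k c y = V k y ⊎ y ≡ c

  KCornered : ℕ → Vertex → Vertex → Set
  KCornered k c x = ∃ λ x' → InF k x x' × Corners (VPlus k c) c x'

  KCaught : ℕ → Vertex → Vertex → Set
  KCaught k c x = InF k x c

-- F_k is a graph homomorphism from G into G_k with nonempty values: a strict
-- corner u of G_k has a strict cornerer that survives into G_{k+1} (strict
-- cornering is transitive and strictly enlarges the neighbourhood within G_k),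
-- and every surviving vertex eventually receives a rank, as the G_k shrink.
-- So after the robber moves from x to y, any y′ ∈ F_k(y) lies in G_k and is
-- adjacent to the vertex x′ ∈ F_k(x) that c corners in G_k ∪ {c}; hence c ~ y′
-- and the cop steps to y′.
module Submission where

open import Defs
open import Data.Nat using (ℕ; _≤_)
open import Data.Product using (∃; _×_)

open import Data.Nat using (zero; suc; _<_; z≤n; s≤s; _≤′_; ≤′-refl; ≤′-step; ≤′-reflexive)
open import Data.Nat.Properties using (≤⇒≤′; m≤n⇒m≤1+n; m<n⇒m<1+n; n<1+n; <⇒≤; _≤?_; ≰⇒>)
open import Data.Nat.Induction using (<-wellFounded)
open import Data.Fin using (Fin; _≟_) renaming (zero to fzero; suc to fsuc)
open import Data.Fin.Properties using (any?; all?)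
open import Data.Product using (_,_; proj₁; proj₂)
open import Data.Sum using (inj₁; inj₂)
open import Data.Unit using (tt)
open import Function using (_∘_)
open import Induction.WellFounded using (Acc; acc)
open import Level using (Level)
open import Relation.Nullary using (¬_; Dec; yes; no; contradiction)
open import Relation.Nullary.Decidable using (_×-dec_; _→-dec_; ¬?)
open import Relation.Binary.PropositionalEquality using (refl)
open import Relation.Unary using (Pred; _⊆_) renaming (Decidable to Decidableᵘ)

size : ∀ {ℓ n} {P : Pred (Fin n) ℓ} → Decidableᵘ P → ℕ
size {n = zero}  P? = 0
size {n = suc n} P? with P? fzero
... | yes _ = suc (size (P? ∘ fsuc))
... | no  _ = size (P? ∘ fsuc)

module _ {ℓ₁ ℓ₂ : Level} where

  size-mono : ∀ {n} {P : Pred (Fin n) ℓ₁} {Q : Pred (Fin n) ℓ₂}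
    (P? : Decidableᵘ P) (Q? : Decidableᵘ Q) → P ⊆ Q → size P? ≤ size Q?
  size-mono {zero}  P? Q? P⊆Q = z≤n
  size-mono {suc n} P? Q? P⊆Q with P? fzero | Q? fzero
  ... | yes _ | yes _  = s≤s (size-mono (P? ∘ fsuc) (Q? ∘ fsuc) P⊆Q)
  ... | yes p | no ¬q  = contradiction (P⊆Q p) ¬q
  ... | no _  | yes _  = m≤n⇒m≤1+n (size-mono (P? ∘ fsuc) (Q? ∘ fsuc) P⊆Q)
  ... | no _  | no _   = size-mono (P? ∘ fsuc) (Q? ∘ fsuc) P⊆Q

  size-strictMono : ∀ {n} {P : Pred (Fin n) ℓ₁} {Q : Pred (Fin n) ℓ₂}
    (P? : Decidableᵘ P) (Q? : Decidableᵘ Q) → P ⊆ Q →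
    ∀ i → Q i → ¬ P i → size P? < size Q?
  size-strictMono {suc n} P? Q? P⊆Q fzero qi ¬pi with P? fzero | Q? fzero
  ... | yes p | _     = contradiction p ¬pi
  ... | no _  | yes _ = s≤s (size-mono (P? ∘ fsuc) (Q? ∘ fsuc) P⊆Q)
  ... | no _  | no ¬q = contradiction qi ¬q
  size-strictMono {suc n} P? Q? P⊆Q (fsuc i) qi ¬pi with P? fzero | Q? fzero
  ... | yes _ | yes _ = s≤s (size-strictMono (P? ∘ fsuc) (Q? ∘ fsuc) P⊆Q i qi ¬pi)
  ... | yes p | no ¬q = contradiction (P⊆Q p) ¬q
  ... | no _  | yes _ = m<n⇒m<1+n (size-strictMono (P? ∘ fsuc) (Q? ∘ fsuc) P⊆Q i qi ¬pi)
  ... | no _  | no _  = size-strictMono (P? ∘ fsuc) (Q? ∘ fsuc) P⊆Q i qi ¬pi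

module Cornering (G : Graph) where
  open Graph G

  strictlyCorners? : (H : VSet G) → Decidableᵘ H → ∀ w v → Dec (StrictlyCorners G H w v)
  strictlyCorners? H H? w v =
    ¬? (w ≟ v)
      ×-dec all? (λ y → H? y →-dec (~-dec y v →-dec ~-dec y w))
      ×-dec any? (λ y → H? y ×-dec ~-dec y w ×-dec ¬? (~-dec y v))

  strictCorner? : (H : VSet G) → Decidableᵘ H → Decidableᵘ (StrictCorner G H)
  strictCorner? H H? v = H? v ×-dec any? (λ w → H? w ×-dec strictlyCorners? H H? w v)

  clique? : (H : VSet G) → Decidableᵘ H → Dec (Clique G H)
  clique? H H? = all? (λ v → all? (λ w → H? v →-dec (H? w →-dec ~-dec v w)))

  V? : ∀ k → Decidableᵘ (V G k)
  V? zero          v = yes tt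
  V? (suc zero)    v = yes tt
  V? (suc (suc k)) v = V? (suc k) v ×-dec ¬? (strictCorner? (V G (suc k)) (V? (suc k)) v)

  corners-adj : ∀ {H c x y} → Corners G H c x → H y → y ~ x → y ~ c
  corners-adj (inj₁ refl)          Hy y~x = y~x
  corners-adj (inj₂ (_ , N[x]⊆N[c])) Hy y~x = N[x]⊆N[c] _ Hy y~x

  strictlyCorners-trans : ∀ {H u w w′} →
    StrictlyCorners G H w′ w → StrictlyCorners G H w u → StrictlyCorners G H w′ u
  strictlyCorners-trans (_ , N[w]⊆N[w′] , y , Hy , y~w′ , y≁w) (_ , N[u]⊆N[w] , z , Hz , z~w , z≁u) =
      (λ { refl → z≁u (N[w]⊆N[w′] z Hz z~w) })
    , (λ v Hv → N[w]⊆N[w′] v Hv ∘ N[u]⊆N[w] v Hv)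
    , y , Hy , y~w′ , y≁w ∘ N[u]⊆N[w] y Hy

  NonNeighbours : VSet G → Vertex G → VSet G
  NonNeighbours H w y = H y × ¬ (y ~ w)

  nonNeighbours? : (H : VSet G) → Decidableᵘ H → ∀ w → Decidableᵘ (NonNeighbours H w)
  nonNeighbours? H H? w y = H? y ×-dec ¬? (~-dec y w)

  strictlyCorners⇒fewerNonNeighbours : ∀ {H} (H? : Decidableᵘ H) {w w′} →
    StrictlyCorners G H w′ w →
    size (nonNeighbours? H H? w′) < size (nonNeighbours? H H? w)
  strictlyCorners⇒fewerNonNeighbours H? (_ , N[w]⊆N[w′] , y , Hy , y~w′ , y≁w) =
    size-strictMono _ _ (λ (Hv , v≁w′) → Hv , v≁w′ ∘ N[w]⊆N[w′] _ Hv)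
      y (Hy , y≁w) (λ (_ , y≁w′) → y≁w′ y~w′)

  -- Following strict cornerers upwards terminates, since each step loses a non-neighbour.
  strictlyCornered-byNonCorner : ∀ {H} (H? : Decidableᵘ H) {u w} →
    H w → StrictlyCorners G H w u →
    ∃ λ z → H z × ¬ StrictCorner G H z × StrictlyCorners G H z u
  strictlyCornered-byNonCorner {H} H? {u} = go (<-wellFounded _)
    where
    go : ∀ {w} → Acc _<_ (size (nonNeighbours? H H? w)) → H w → StrictlyCorners G H w u →
      ∃ λ z → H z × ¬ StrictCorner G H z × StrictlyCorners G H z u
    go {w} (acc rec) Hw w▹u with strictCorner? H H? w
    ... | no ¬sc = w , Hw , ¬sc , w▹u
    ... | yes (_ , w′ , Hw′ , w′▹w) =
      go (rec (strictlyCorners⇒fewerNonNeighbours H? w′▹w)) Hw′ (strictlyCorners-trans w′▹w w▹u)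

  V-anti : ∀ {a b} → a ≤ b → V G b ⊆ V G a
  V-anti = go ∘ ≤⇒≤′
    where
    V-suc⊆ : ∀ k → V G (suc k) ⊆ V G k
    V-suc⊆ zero    _ = tt
    V-suc⊆ (suc k)   = proj₁
    go : ∀ {a b} → a ≤′ b → V G b ⊆ V G a
    go ≤′-refl            = λ Vv → Vv
    go (≤′-step {b} a≤b) = go a≤b ∘ V-suc⊆ b

  Defined-anti : ∀ {a b} → suc a ≤ b → Defined G b → Defined G (suc a)
  Defined-anti = go ∘ ≤⇒≤′
    where
    go : ∀ {a b} → suc a ≤′ b → Defined G b → Defined G (suc a)
    go ≤′-refl                 D = D
    go (≤′-step {zero} (≤′-reflexive ()))
    go (≤′-step {suc b} a<b) D = go a<b (proj₁ D)

  V-shrinks : ∀ {m} → Defined G (suc (suc m)) → size (V? (suc (suc m))) < size (V? (suc m))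
  V-shrinks (_ , _ , u , sc@(Vu , _)) = size-strictMono _ _ proj₁ u Vu (λ (_ , ¬sc) → ¬sc sc)

  rankAbove-suc : ∀ {u m} → RankAbove G u (suc m) → RankAbove G u m
  rankAbove-suc (fin r , h , m+1<r) = fin r , h , <⇒≤ m+1<r
  rankAbove-suc (∞ , h , _)         = ∞ , h , tt

  rankAbove-exists : ∀ m {u} → Defined G (suc m) → V G (suc m) u → RankAbove G u m
  rankAbove-exists m = go m (<-wellFounded _)
    where
    go : ∀ m {u} → Acc _<_ (size (V? (suc m))) → Defined G (suc m) → V G (suc m) u →
      RankAbove G u m
    go m {u} (acc rec) D Vu with clique? (V G (suc m)) (V? (suc m))
    ... | yes cl = fin (suc m) , (D , Vu , inj₁ cl) , n<1+n m
    ... | no ¬cl with any? (strictCorner? (V G (suc m)) (V? (suc m)))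
    ...   | no ¬sc = ∞ , (suc m , D , Vu , ¬cl , ¬sc) , tt
    ...   | yes sc with strictCorner? (V G (suc m)) (V? (suc m)) u
    ...     | yes sc-u = fin (suc m) , (D , Vu , inj₂ sc-u) , n<1+n m
    ...     | no ¬sc-u = rankAbove-suc (go (suc m) (rec (V-shrinks D′)) D′ (Vu , ¬sc-u))
      where D′ = D , ¬cl , sc

  -- An ∞ rank assigned at a level below k+1 would have stopped the process before G_{k+1}.
  rankAbove⇒V : ∀ k {u} → Defined G (suc k) → RankAbove G u k → V G (suc k) u
  rankAbove⇒V k D (fin m , (_ , Vu , _) , k<m) = V-anti k<m Vu
  rankAbove⇒V k D (∞ , (suc m , _ , Vu , _ , ¬sc) , _) with suc k ≤? suc m
  ... | yes k<m = V-anti k<m Vu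
  ... | no  k≮m = contradiction (proj₂ (proj₂ (Defined-anti (≰⇒> k≮m) D))) ¬sc

  proj-nonempty : ∀ k {u} → Defined G (suc (suc k)) → V G (suc k) u → ∃ (InProj G (suc k) u)
  proj-nonempty k {u} D Vu with strictCorner? (V G (suc k)) (V? (suc k)) u
  ... | no ¬sc = u , inj₁ (rankAbove-exists (suc k) D (Vu , ¬sc) , refl)
  ... | yes sc@(_ , w , Vw , w▹u) with strictlyCornered-byNonCorner (V? (suc k)) Vw w▹u
  ...   | z , Vz , ¬sc-z , z▹u =
    z , inj₂ ((λ ra → proj₂ (rankAbove⇒V (suc k) D ra) sc) , (Vz , ¬sc-z) , z▹u)

  proj-preserves-~ : ∀ k {u v u′ v′} → V G (suc k) u → V G (suc k) v → u ~ v →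
    InProj G (suc k) u u′ → InProj G (suc k) v v′ → u′ ~ v′
  proj-preserves-~ k Vu Vv u~v (inj₁ (_ , refl)) (inj₁ (_ , refl)) = u~v
  proj-preserves-~ k Vu Vv u~v (inj₁ (_ , refl)) (inj₂ (_ , _ , _ , N[v]⊆N[v′] , _)) =
    N[v]⊆N[v′] _ Vu u~v
  proj-preserves-~ k Vu Vv u~v (inj₂ (_ , _ , _ , N[u]⊆N[u′] , _)) (inj₁ (_ , refl)) =
    ~-sym (N[u]⊆N[u′] _ Vv (~-sym u~v))
  proj-preserves-~ k Vu Vv u~v (inj₂ (_ , (Vu′ , _) , _ , N[u]⊆N[u′] , _)) (inj₂ (_ , _ , _ , N[v]⊆N[v′] , _)) =
    N[v]⊆N[v′] _ Vu′ (~-sym (N[u]⊆N[u′] _ Vv (~-sym u~v)))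

  F⊆V : ∀ k {y z} → Defined G k → InF G k y z → V G k z
  F⊆V (suc zero)    _ _                            = tt
  F⊆V (suc (suc k)) D (_ , _ , inj₁ (ra , refl))   = rankAbove⇒V (suc k) D ra
  F⊆V (suc (suc k)) D (_ , _ , inj₂ (_ , Vz , _))  = Vz

  F-nonempty : ∀ k → Defined G k → ∀ y → ∃ (InF G k y)
  F-nonempty (suc zero)    _ y = y , refl
  F-nonempty (suc (suc k)) D y with F-nonempty (suc k) (proj₁ D) y
  ... | u , y↦u with proj-nonempty k D (F⊆V (suc k) (proj₁ D) y↦u)
  ...   | z , u↦z = z , u , y↦u , u↦z

  F-preserves-~ : ∀ k {x y x′ y′} → Defined G k → InF G k x x′ → InF G k y y′ → x ~ y → x′ ~ y′
  F-preserves-~ (suc zero)    _ refl refl x~y = x~y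
  F-preserves-~ (suc (suc k)) D (u , x↦u , u↦x′) (v , y↦v , v↦y′) x~y =
    proj-preserves-~ k (F⊆V (suc k) (proj₁ D) x↦u) (F⊆V (suc k) (proj₁ D) y↦v)
      (F-preserves-~ (suc k) (proj₁ D) x↦u y↦v x~y) u↦x′ v↦y′

-- The hypothesis 1 ≤ k is implied by Defined G k, which is empty for k = 0.
lemma4p3 : (G : Graph) (k : ℕ) → 1 ≤ k → Defined G k →
    ∀ (c x : Vertex G) → KCornered G k c x →
    ∀ (y : Vertex G) → Graph._~_ G x y →
    ∃ λ (c' : Vertex G) → Graph._~_ G c c' × KCaught G k c' y
lemma4p3 G k _ D c x (x′ , x↦x′ , c⊒x′) y x~y with Cornering.F-nonempty G k D y
... | y′ , y↦y′ = y′ , ~-sym y′~c , y↦y′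
  where
  open Graph G
  open Cornering G
  y′~c : y′ ~ c
  y′~c = corners-adj c⊒x′ (inj₁ (F⊆V k D y↦y′)) (~-sym (F-preserves-~ k D x↦x′ y↦y′ x~y))
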